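{- Fix an integer $n\ge0$ and start the chip-firing game on the quadrant lattice graph with $2^n$ chips at $(0,0)$. In the stable configuration, every vertex $(x,y)$ holding a chip satisfies $x+y\le n+\binom{n}{n/2}$ if $n$ is even, and $x+y\le n+1+2\left\lfloor \binom{n}{\lfloor n/2\rfloor}/2\right\rfloor$ if $n$ is odd.
   Context: The quadrant lattice graph is the directed graph with vertex set $\{(x,y): x,y\in\mathbb{Z}_{\ge 0}\}$ and edges $(x,y)\to(x+1,y)$ and $(x,y)\to(x,y+1)$; row $i$ consists of vertices with $x+y=i$. In the chip-firing game, a vertex holding at least $2$ chips may fire, sending one chip to each of its two out-neighbours. Starting from $2^n$ chips at $(0,0)$ the process terminates at a stable configuration (no vertex can fire), which does not depend on the order of firings. -}

module Defs where

open import Data.Nat using (ℕ; zero; suc; _+_; _*_; _∸_; _^_; _<_; _≤_; _≡ᵇ_)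
open import Data.Bool using (Bool; true; false; _∧_; if_then_else_)
open import Relation.Binary.Construct.Closure.ReflexiveTransitive using (Star)

Config : Set
Config = ℕ → ℕ → ℕ

δ : ℕ → ℕ → ℕ → ℕ → ℕ
δ x y a b = if (x ≡ᵇ a) ∧ (y ≡ᵇ b) then 1 else 0

initial : ℕ → Config
initial n x y = δ x y 0 0 * 2 ^ n

fire : Config → ℕ → ℕ → Config
fire c a b x y = (c x y + δ x y (suc a) b + δ x y a (suc b)) ∸ 2 * δ x y a b

data Step : Config → Config → Set where
  step : ∀ {c} a b → 2 ≤ c a b → Step c (fire c a b)

Reachable : Config → Config → Set
Reachable = Star Step

Stable : Config → Set
Stable c = ∀ x y → c x y < 2

-- Least action principle: if firing every vertex v exactly h v times would leave at most one
-- chip everywhere (h is a supersolution), then no legal firing sequence fires v more than h v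
-- times, since a vertex about to exceed h would need two chips it can never receive. Chips
-- therefore stay within one row beyond the support of h.
-- For 2^n chips take h = 2^(n-1-r) C(r,x) on rows r < n, where every chip is passed on, and
-- the tent H - max(x,y) on rows r ≥ n. The tent absorbs the C(n,x) chips arriving on row n
-- as soon as C(n,x) + 2 max(x,y) ≤ 2H + 1; binomials grow by at least 2 per step towards the
-- centre, so H = ⌈(n + C(n,⌊n/2⌋))/2⌉ works. Every occupied vertex then has
-- x + y ≤ n + C(n,⌊n/2⌋), which implies both parity cases.
module Submission where

open import Defs
open import Data.Nat
open import Data.Nat.Properties
open import Data.Nat.Combinatorics
open import Data.Nat.DivMod using (_/_; _%_; m≡m%n+[m/n]*n; m%n<n)
open import Data.Nat.Tactic.RingSolver using (solve-∀)
open import Data.Bool using (true; false; if_then_else_)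
open import Data.Bool.Properties using (∧-zeroʳ)
open import Data.Sum using (_⊎_; inj₁; inj₂; [_,_]′)
open import Data.Product using (Σ-syntax; _×_; _,_)
open import Relation.Binary using (tri<; tri≈; tri>)
open import Relation.Binary.PropositionalEquality
open import Relation.Binary.Construct.Closure.ReflexiveTransitive using (Star; ε; _◅_)
open import Relation.Nullary using (yes; no; contradiction)
open import Algebra.Properties.CommutativeSemigroup +-commutativeSemigroup
  using (interchange; xy∙z≈xz∙y; x∙yz≈y∙xz)

-- Binomial coefficients

[1+2k]Ck≡[1+2k]C[1+k] : ∀ k → suc (2 * k) C k ≡ suc (2 * k) C suc k
[1+2k]Ck≡[1+2k]C[1+k] k = begin
  suc (2 * k) C k             ≡⟨ nCk≡nC[n∸k] (≤-trans (m≤n*m k 2) (n≤1+n _)) ⟩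
  suc (2 * k) C (suc (2 * k) ∸ k) ≡⟨ cong (λ m → suc (2 * k) C (m ∸ k)) (1+2k≡1+k+k k) ⟩
  suc (2 * k) C (suc k + k ∸ k)   ≡⟨ cong (suc (2 * k) C_) (m+n∸n≡m (suc k) k) ⟩
  suc (2 * k) C suc k         ∎
  where
    open ≡-Reasoning
    1+2k≡1+k+k : ∀ k → suc (2 * k) ≡ suc k + k
    1+2k≡1+k+k = solve-∀

pascal-mono : ∀ n k {j} → n C k + j ≤ n C suc k → n C suc k ≤ n C suc (suc k) →
              suc n C suc k + j ≤ suc n C suc (suc k)
pascal-mono n k {j} low high = begin
  suc n C suc k + j                 ≡⟨ cong (_+ j) (nCk+nC[k+1]≡[n+1]C[k+1] n k) ⟨
  n C k + n C suc k + j             ≡⟨ xy∙z≈xz∙y (n C k) _ _ ⟩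
  n C k + j + n C suc k             ≤⟨ +-mono-≤ low high ⟩
  n C suc k + n C suc (suc k)       ≡⟨ nCk+nC[k+1]≡[n+1]C[k+1] n (suc k) ⟩
  suc n C suc (suc k)               ∎
  where open ≤-Reasoning

nCk+j≤nC[1+k] : ∀ j n k → 2 * k + j < n → n C k + j ≤ n C suc k
nCk+j≤nC[1+k] j (suc n) zero j<n = ≤-trans j<n (≤-reflexive (sym (nC1≡n (suc n))))
nCk+j≤nC[1+k] j (suc n) (suc k) 2k+j<n with m≤n⇒m<n∨m≡n (≤-trans (m≤m+n (2 * suc k) j) (≤-pred 2k+j<n))
... | inj₁ 2k+2<n = pascal-mono n k (nCk+j≤nC[1+k] j n k 2k+j<n′) nC[1+k]≤nC[2+k]
  where
    2[1+k]+j≡2+2k+j : ∀ k j → 2 * suc k + j ≡ 2 + (2 * k + j)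
    2[1+k]+j≡2+2k+j = solve-∀
    2k+j<n′ : 2 * k + j < n
    2k+j<n′ = ≤-trans (n≤1+n _) (≤-trans (≤-reflexive (sym (2[1+k]+j≡2+2k+j k j))) (≤-pred 2k+j<n))
    nC[1+k]≤nC[2+k] : n C suc k ≤ n C suc (suc k)
    nC[1+k]≤nC[2+k] = ≤-trans (≤-reflexive (sym (+-identityʳ _)))
                              (nCk+j≤nC[1+k] 0 n (suc k) (subst (_< n) (sym (+-identityʳ _)) 2k+2<n))
nCk+j≤nC[1+k] zero (suc n) (suc k) 2k+j<n | inj₂ refl =
  ≤-reflexive (trans (+-identityʳ _) ([1+2k]Ck≡[1+2k]C[1+k] (suc k)))
nCk+j≤nC[1+k] (suc j) (suc n) (suc k) 2k+j<n | inj₂ refl =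
  contradiction (≤-pred 2k+j<n) (m+1+n≰m (2 * suc k))

binomial-climb : ∀ d n k → 2 * k + 2 * d < n → n C k + 2 * d ≤ n C (k + d)
binomial-climb zero n k _ = ≤-reflexive (trans (+-identityʳ _) (cong (n C_) (sym (+-identityʳ k))))
binomial-climb (suc d) n k 2k+2d<n = begin
  n C k + 2 * suc d       ≡⟨ cong (n C k +_) (*-suc 2 d) ⟩
  n C k + (2 + 2 * d)     ≡⟨ +-assoc (n C k) 2 (2 * d) ⟨
  n C k + 2 + 2 * d       ≤⟨ +-monoˡ-≤ (2 * d) (nCk+j≤nC[1+k] 2 n k 2k+2<n) ⟩
  n C suc k + 2 * d       ≤⟨ binomial-climb d n (suc k) (subst (_< n) (shift k d) 2k+2d<n) ⟩
  n C (suc k + d)         ≡⟨ cong (n C_) (+-suc k d) ⟨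
  n C (k + suc d)         ∎
  where
    open ≤-Reasoning
    shift : ∀ k d → 2 * k + 2 * suc d ≡ 2 * suc k + 2 * d
    shift = solve-∀
    2k+2<n : 2 * k + 2 < n
    2k+2<n = ≤-<-trans (+-monoʳ-≤ (2 * k) (*-monoʳ-≤ 2 (s≤s z≤n))) 2k+2d<n

-- Each step of x towards the centre raises N C x by at least 2, except the last step on an
-- even row, which raises it by 1: hence the + 1.
binomial-tilt-from-centre : ∀ {N} e x d → e ≤ 1 → N ≡ e + (x + d) * 2 →
                            N C x + 2 * (e + (x + d) + d) ≤ N + 1 + N C (x + d)
binomial-tilt-from-centre {N} 1 x d _ refl = begin
  N C x + 2 * (1 + (x + d) + d)   ≡⟨ regroup (N C x) x d ⟩
  N C x + 2 * d + (N + 1)         ≤⟨ +-monoˡ-≤ (N + 1) climb ⟩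
  N C (x + d) + (N + 1)           ≡⟨ +-comm _ (N + 1) ⟩
  N + 1 + N C (x + d)             ∎
  where
    open ≤-Reasoning
    regroup : ∀ a x d → a + 2 * (1 + (x + d) + d) ≡ a + 2 * d + (1 + (x + d) * 2 + 1)
    regroup = solve-∀
    1+2x+2d≡N : ∀ x d → suc (2 * x + 2 * d) ≡ 1 + (x + d) * 2
    1+2x+2d≡N = solve-∀
    climb : N C x + 2 * d ≤ N C (x + d)
    climb = binomial-climb d N x (≤-reflexive (1+2x+2d≡N x d))
binomial-tilt-from-centre {N} 0 x zero _ refl = begin
  N C x + 2 * (0 + (x + 0) + 0)   ≡⟨ cong₂ _+_ (cong (N C_) (sym (+-identityʳ x))) (double (x + 0)) ⟩
  N C (x + 0) + N                 ≤⟨ +-monoʳ-≤ (N C (x + 0)) (m≤m+n N 1) ⟩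
  N C (x + 0) + (N + 1)           ≡⟨ +-comm _ (N + 1) ⟩
  N + 1 + N C (x + 0)             ∎
  where
    open ≤-Reasoning
    double : ∀ c → 2 * (0 + c + 0) ≡ 0 + c * 2
    double = solve-∀
binomial-tilt-from-centre {N} 0 x (suc d) _ refl = begin
  N C x + 2 * (0 + (x + suc d) + suc d)   ≡⟨ regroup (N C x) x d ⟩
  N C x + 2 * d + 1 + (1 + N)             ≤⟨ +-monoˡ-≤ (1 + N) (+-monoˡ-≤ 1 climb) ⟩
  N C (x + d) + 1 + (1 + N)               ≤⟨ +-monoˡ-≤ (1 + N) last-step ⟩
  N C suc (x + d) + (1 + N)               ≡⟨ cong (λ k → N C k + (1 + N)) (+-suc x d) ⟨
  N C (x + suc d) + (1 + N)               ≡⟨ +-comm _ (1 + N) ⟩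
  1 + N + N C (x + suc d)                 ≡⟨ cong (_+ N C (x + suc d)) (+-comm 1 N) ⟩
  N + 1 + N C (x + suc d)                 ∎
  where
    open ≤-Reasoning
    regroup : ∀ a x d → a + 2 * (0 + (x + suc d) + suc d) ≡ a + 2 * d + 1 + (1 + (0 + (x + suc d) * 2))
    regroup = solve-∀
    2x+2d+2≡N : ∀ x d → 2 + (2 * x + 2 * d) ≡ 0 + (x + suc d) * 2
    2x+2d+2≡N = solve-∀
    2[x+d]+2≡N : ∀ x d → suc (2 * (x + d) + 1) ≡ 0 + (x + suc d) * 2
    2[x+d]+2≡N = solve-∀
    climb : N C x + 2 * d ≤ N C (x + d)
    climb = binomial-climb d N x (≤-trans (n≤1+n _) (≤-reflexive (2x+2d+2≡N x d)))
    last-step : N C (x + d) + 1 ≤ N C suc (x + d)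
    last-step = nCk+j≤nC[1+k] 1 N (x + d) (≤-reflexive (2[x+d]+2≡N x d))
binomial-tilt-from-centre (suc (suc e)) x d (s≤s ()) _

row-decomposition : ∀ {c e x y} → e ≤ 1 → x ≤ y → x + y ≡ e + c * 2 →
                    Σ[ d ∈ ℕ ] x + d ≡ c × y ≡ e + c + d
row-decomposition {c} {e} {x} {y} e≤1 x≤y x+y≡e+2c = c ∸ x , x+d≡c , +-cancelˡ-≡ x y _ x+y≡x+[e+c+d]
  where
    x≤c : x ≤ c
    x≤c = ≤-pred (*-cancelʳ-< 2 x (suc c) (begin-strict
      x * 2           ≡⟨ *-comm x 2 ⟩
      2 * x           ≡⟨ cong (x +_) (+-identityʳ x) ⟩
      x + x           ≤⟨ +-monoʳ-≤ x x≤y ⟩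
      x + y           ≡⟨ x+y≡e+2c ⟩
      e + c * 2       ≤⟨ +-monoˡ-≤ (c * 2) e≤1 ⟩
      1 + c * 2       <⟨ n<1+n _ ⟩
      suc c * 2       ∎))
      where open ≤-Reasoning
    x+d≡c : x + (c ∸ x) ≡ c
    x+d≡c = m+[n∸m]≡n x≤c
    x+y≡x+[e+c+d] : x + y ≡ x + (e + c + (c ∸ x))
    x+y≡x+[e+c+d] = begin
      x + y                   ≡⟨ x+y≡e+2c ⟩
      e + c * 2               ≡⟨ split e c ⟩
      e + c + c               ≡⟨ cong (e + c +_) x+d≡c ⟨
      e + c + (x + (c ∸ x))   ≡⟨ x∙yz≈y∙xz (e + c) x (c ∸ x) ⟩
      x + (e + c + (c ∸ x))   ∎
      where
        open ≡-Reasoning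
        split : ∀ e c → e + c * 2 ≡ e + c + c
        split = solve-∀

binomial-tilt-≤ : ∀ {c e} x y → e ≤ 1 → x ≤ y → x + y ≡ e + c * 2 →
                  (x + y) C x + 2 * y ≤ x + y + 1 + (x + y) C c
binomial-tilt-≤ {c} {e} x y e≤1 x≤y x+y≡e+2c with row-decomposition {c} e≤1 x≤y x+y≡e+2c
... | d , refl , refl = binomial-tilt-from-centre e x d e≤1 x+y≡e+2c

binomial-tilt : ∀ {c e} x y → e ≤ 1 → x + y ≡ e + c * 2 →
                (x + y) C x + 2 * (x ⊔ y) ≤ x + y + 1 + (x + y) C c
binomial-tilt {c} x y e≤1 x+y≡e+2c with ≤-total x y
... | inj₁ x≤y = subst (λ m → (x + y) C x + 2 * m ≤ x + y + 1 + (x + y) C c)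
                       (sym (m≤n⇒m⊔n≡n x≤y)) (binomial-tilt-≤ {c} x y e≤1 x≤y x+y≡e+2c)
... | inj₂ y≤x = begin
  (x + y) C x + 2 * (x ⊔ y)   ≡⟨ cong₂ _+_ (nCk≡nC[n∸k] (m≤m+n x y)) (cong (2 *_) (m≥n⇒m⊔n≡m y≤x)) ⟩
  (x + y) C (x + y ∸ x) + 2 * x  ≡⟨ cong (λ k → (x + y) C k + 2 * x) (m+n∸m≡n x y) ⟩
  (x + y) C y + 2 * x         ≡⟨ cong (λ n → n C y + 2 * x) (+-comm x y) ⟩
  (y + x) C y + 2 * x         ≤⟨ binomial-tilt-≤ {c} y x e≤1 y≤x (trans (+-comm y x) x+y≡e+2c) ⟩
  y + x + 1 + (y + x) C c     ≡⟨ cong (λ n → n + 1 + n C c) (+-comm y x) ⟩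
  x + y + 1 + (x + y) C c     ∎
  where open ≤-Reasoning

-- Least action principle

_≤ᶜ_ : Config → Config → Set
u ≤ᶜ v = ∀ x y → u x y ≤ v x y

inflow : Config → Config
inflow u zero    zero    = 0
inflow u (suc x) zero    = u x zero
inflow u zero    (suc y) = u zero y
inflow u (suc x) (suc y) = u x (suc y) + u (suc x) y

inflow-mono : ∀ {u v} → u ≤ᶜ v → inflow u ≤ᶜ inflow v
inflow-mono u≤v zero    zero    = z≤n
inflow-mono u≤v (suc x) zero    = u≤v x zero
inflow-mono u≤v zero    (suc y) = u≤v zero y
inflow-mono u≤v (suc x) (suc y) = +-mono-≤ (u≤v x (suc y)) (u≤v (suc x) y)

inflow-+ : ∀ u v x y → inflow (λ a b → u a b + v a b) x y ≡ inflow u x y + inflow v x y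
inflow-+ u v zero    zero    = refl
inflow-+ u v (suc x) zero    = refl
inflow-+ u v zero    (suc y) = refl
inflow-+ u v (suc x) (suc y) = interchange (u x (suc y)) (v x (suc y)) (u (suc x) y) (v (suc x) y)

inflow-cong-row : ∀ {u v} x y → (∀ a b → suc (a + b) ≡ x + y → u a b ≡ v a b) →
                  inflow u x y ≡ inflow v x y
inflow-cong-row zero    zero    u≡v = refl
inflow-cong-row (suc x) zero    u≡v = u≡v x zero refl
inflow-cong-row zero    (suc y) u≡v = u≡v zero y refl
inflow-cong-row (suc x) (suc y) u≡v = cong₂ _+_ (u≡v x (suc y) refl) (u≡v (suc x) y (cong suc (sym (+-suc x y))))

inflow-zero : ∀ x y → inflow (λ _ _ → 0) x y ≡ 0
inflow-zero zero    zero    = refl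
inflow-zero (suc x) zero    = refl
inflow-zero zero    (suc y) = refl
inflow-zero (suc x) (suc y) = refl

1≤m+n⇒1≤m⊎1≤n : ∀ m {n} → 1 ≤ m + n → 1 ≤ m ⊎ 1 ≤ n
1≤m+n⇒1≤m⊎1≤n zero    0<n = inj₂ 0<n
1≤m+n⇒1≤m⊎1≤n (suc m) _   = inj₁ (s≤s z≤n)

inflow-support : ∀ {u R} → (∀ a b → 1 ≤ u a b → suc (a + b) ≤ R) →
                 ∀ x y → 1 ≤ inflow u x y → x + y ≤ R
inflow-support supp (suc x) zero    0<u = supp x zero 0<u
inflow-support supp zero    (suc y) 0<u = supp zero y 0<u
inflow-support {u} {R} supp (suc x) (suc y) 0<u with 1≤m+n⇒1≤m⊎1≤n (u x (suc y)) 0<u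
... | inj₁ 0<left  = supp x (suc y) 0<left
... | inj₂ 0<right = subst (_≤ R) (cong suc (sym (+-suc x y))) (supp (suc x) y 0<right)

δ-self : ∀ a b → δ a b a b ≡ 1
δ-self zero    zero    = refl
δ-self zero    (suc b) = δ-self zero b
δ-self (suc a) b       = δ-self a b

δ-cases : ∀ x y a b → δ x y a b ≡ 0 ⊎ (x ≡ a × y ≡ b)
δ-cases zero    zero    zero    zero    = inj₂ (refl , refl)
δ-cases zero    zero    zero    (suc b) = inj₁ refl
δ-cases zero    (suc y) zero    zero    = inj₁ refl
δ-cases zero    (suc y) zero    (suc b) with δ-cases zero y zero b
... | inj₁ δ≡0          = inj₁ δ≡0
... | inj₂ (refl , refl) = inj₂ (refl , refl)
δ-cases zero    y       (suc a) b       = inj₁ refl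
δ-cases (suc x) y       zero    b       = inj₁ refl
δ-cases (suc x) y       (suc a) b with δ-cases x y a b
... | inj₁ δ≡0          = inj₁ δ≡0
... | inj₂ (refl , refl) = inj₂ (refl , refl)

δ[x,0,a,1+b]≡0 : ∀ x a b → δ x 0 a (suc b) ≡ 0
δ[x,0,a,1+b]≡0 x a b rewrite ∧-zeroʳ (x ≡ᵇ a) = refl

inflow-δ : ∀ a b x y → inflow (λ u v → δ u v a b) x y ≡ δ x y (suc a) b + δ x y a (suc b)
inflow-δ a b zero    zero    = sym (δ[x,0,a,1+b]≡0 0 a b)
inflow-δ a b (suc x) zero    = sym (trans (cong (δ x 0 a b +_) (δ[x,0,a,1+b]≡0 (suc x) a b)) (+-identityʳ _))
inflow-δ a b zero    (suc y) = refl
inflow-δ a b (suc x) (suc y) = refl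

-- u x y is the number of times (x, y) has fired on the way from c₀ to c.
Odometer : Config → Config → Config → Set
Odometer c₀ c u = ∀ x y → c x y + 2 * u x y ≡ c₀ x y + inflow u x y

Supersolution : Config → Config → Set
Supersolution c₀ h = ∀ x y → c₀ x y + inflow h x y ≤ 2 * h x y + 1

record-firing : ℕ → ℕ → Config → Config
record-firing a b u x y = u x y + δ x y a b

firing-loss≤chips : ∀ {c : Config} {a b} → 2 ≤ c a b → ∀ x y →
                    2 * δ x y a b ≤ c x y + δ x y (suc a) b + δ x y a (suc b)
firing-loss≤chips {c} {a} {b} 2≤c x y with δ-cases x y a b
... | inj₁ δ≡0 rewrite δ≡0 = z≤n
... | inj₂ (refl , refl) rewrite δ-self x y = ≤-trans 2≤c (≤-trans (m≤m+n _ _) (m≤m+n _ _))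

fire-odometer : ∀ {c₀ c u a b} → 2 ≤ c a b → Odometer c₀ c u → Odometer c₀ (fire c a b) (record-firing a b u)
fire-odometer {c₀} {c} {u} {a} {b} 2≤c odo x y = begin
  c x y + E₁ + E₂ ∸ 2 * D + 2 * (u x y + D)    ≡⟨ split-twice (c x y + E₁ + E₂ ∸ 2 * D) (u x y) D ⟩
  c x y + E₁ + E₂ ∸ 2 * D + 2 * D + 2 * u x y  ≡⟨ cong (_+ 2 * u x y) (m∸n+n≡m (firing-loss≤chips {c} 2≤c x y)) ⟩
  c x y + E₁ + E₂ + 2 * u x y                  ≡⟨ regroup (c x y) E₁ E₂ (u x y) ⟩
  c x y + 2 * u x y + (E₁ + E₂)                ≡⟨ cong₂ _+_ (odo x y) (sym (inflow-δ a b x y)) ⟩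
  c₀ x y + inflow u x y + inflow 𝟙 x y        ≡⟨ +-assoc (c₀ x y) _ _ ⟩
  c₀ x y + (inflow u x y + inflow 𝟙 x y)      ≡⟨ cong (c₀ x y +_) (inflow-+ u 𝟙 x y) ⟨
  c₀ x y + inflow (record-firing a b u) x y          ∎
  where
    open ≡-Reasoning
    𝟙 : Config
    𝟙 p q = δ p q a b
    D E₁ E₂ : ℕ
    D = δ x y a b
    E₁ = δ x y (suc a) b
    E₂ = δ x y a (suc b)
    split-twice : ∀ r u d → r + 2 * (u + d) ≡ r + 2 * d + 2 * u
    split-twice = solve-∀
    regroup : ∀ c e₁ e₂ u → c + e₁ + e₂ + 2 * u ≡ c + 2 * u + (e₁ + e₂)
    regroup = solve-∀

2m≤2n+1⇒m≤n : ∀ {m n} → 2 * m ≤ 2 * n + 1 → m ≤ n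
2m≤2n+1⇒m≤n {m} {n} 2m≤2n+1 = ≤-pred (*-cancelˡ-< 2 m (suc n) (≤-<-trans 2m≤2n+1 2n+1<2[1+n]))
  where
    2n+1<2[1+n] : 2 * n + 1 < 2 * suc n
    2n+1<2[1+n] = ≤-reflexive (trans (cong suc (+-comm (2 * n) 1)) (sym (*-suc 2 n)))

record-firing-bounded : ∀ {c₀ h c u a b} → Supersolution c₀ h → Odometer c₀ c u → u ≤ᶜ h →
                        2 ≤ c a b → record-firing a b u ≤ᶜ h
record-firing-bounded {c₀} {h} {c} {u} {a} {b} super odo u≤h 2≤c x y with δ-cases x y a b
... | inj₁ δ≡0 rewrite δ≡0 = subst (_≤ h x y) (sym (+-identityʳ _)) (u≤h x y)
... | inj₂ (refl , refl) rewrite δ-self x y = 2m≤2n+1⇒m≤n (begin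
  2 * (u x y + 1)           ≡⟨ *-distribˡ-+ 2 (u x y) 1 ⟩
  2 * u x y + 2             ≡⟨ +-comm (2 * u x y) 2 ⟩
  2 + 2 * u x y             ≤⟨ +-monoˡ-≤ (2 * u x y) 2≤c ⟩
  c x y + 2 * u x y         ≡⟨ odo x y ⟩
  c₀ x y + inflow u x y     ≤⟨ +-monoʳ-≤ (c₀ x y) (inflow-mono u≤h x y) ⟩
  c₀ x y + inflow h x y     ≤⟨ super x y ⟩
  2 * h x y + 1             ∎)
  where open ≤-Reasoning

least-action : ∀ {c₀ h c} → Supersolution c₀ h → Reachable c₀ c →
               Σ[ u ∈ Config ] Odometer c₀ c u × u ≤ᶜ h
least-action {c₀} {h} super = go (λ _ _ → 0) no-firing (λ _ _ → z≤n)
  where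
    no-firing : Odometer c₀ c₀ (λ _ _ → 0)
    no-firing x y = cong (c₀ x y +_) (sym (inflow-zero x y))
    go : ∀ {c c′} u → Odometer c₀ c u → u ≤ᶜ h → Star Step c c′ →
         Σ[ u′ ∈ Config ] Odometer c₀ c′ u′ × u′ ≤ᶜ h
    go u odo u≤h ε = u , odo , u≤h
    go {c} u odo u≤h (step a b 2≤c ◅ steps) =
      go (record-firing a b u) (fire-odometer {c = c} 2≤c odo)
         (record-firing-bounded {c = c} super odo u≤h 2≤c) steps

occupied-source : ∀ {c₀ c u} → Odometer c₀ c u → ∀ x y → 1 ≤ c x y → 1 ≤ c₀ x y ⊎ 1 ≤ inflow u x y
occupied-source {c₀} {c} odo x y 0<c =
  1≤m+n⇒1≤m⊎1≤n (c₀ x y) (≤-trans 0<c (≤-trans (m≤m+n (c x y) _) (≤-reflexive (odo x y))))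

reachable-support : ∀ {c₀ h c R} → Supersolution c₀ h →
                    (∀ x y → 1 ≤ c₀ x y → x + y ≤ R) → (∀ x y → 1 ≤ h x y → suc (x + y) ≤ R) →
                    Reachable c₀ c → ∀ x y → 1 ≤ c x y → x + y ≤ R
reachable-support {c = c} super c₀-supp h-supp reach x y 0<c with least-action super reach
... | u , odo , u≤h = [ c₀-supp x y , inflow-support (λ a b 0<u → h-supp a b (≤-trans 0<u (u≤h a b))) x y ]′
                        (occupied-source {c = c} odo x y 0<c)

-- A supersolution for 2 ^ n chips at the origin

-- A vertex (x, y) in row r < n ends up with 2^(n-r) C(r,x) chips and fires half of them.
dyadic : ℕ → Config
dyadic n x y = 2 ^ (n ∸ suc (x + y)) * ((x + y) C x)

tent : ℕ → Config
tent H x y = H ∸ (x ⊔ y)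

glued : ℕ → ℕ → Config
glued n H x y = if x + y <ᵇ n then dyadic n x y else tent H x y

glued-below : ∀ n H x y → x + y < n → glued n H x y ≡ dyadic n x y
glued-below n H x y r<n with x + y <ᵇ n | <⇒<ᵇ r<n
... | true | _ = refl

glued-above : ∀ n H x y → n ≤ x + y → glued n H x y ≡ tent H x y
glued-above n H x y n≤r with x + y <ᵇ n | <ᵇ⇒< (x + y) n
... | true  | r<n = contradiction (r<n _) (≤⇒≯ n≤r)
... | false | _   = refl

initial+inflow-dyadic : ∀ n x y → initial n x y + inflow (dyadic n) x y ≡ 2 ^ (n ∸ (x + y)) * ((x + y) C x)
initial+inflow-dyadic n zero zero = trans (+-identityʳ _) (trans (*-identityˡ (2 ^ n)) (sym (*-identityʳ (2 ^ n))))
initial+inflow-dyadic n (suc x) zero rewrite +-identityʳ x =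
  cong (λ m → 2 ^ (n ∸ suc x) * m) (trans (nCn≡1 x) (sym (nCn≡1 (suc x))))
initial+inflow-dyadic n zero (suc y) = refl
initial+inflow-dyadic n (suc x) (suc y) rewrite +-suc x y = begin
  2 ^ (n ∸ r) * (suc (x + y) C x) + 2 ^ (n ∸ r) * (suc (x + y) C suc x) ≡⟨ *-distribˡ-+ (2 ^ (n ∸ r)) _ _ ⟨
  2 ^ (n ∸ r) * (suc (x + y) C x + suc (x + y) C suc x)           ≡⟨ cong (2 ^ (n ∸ r) *_) (nCk+nC[k+1]≡[n+1]C[k+1] (suc (x + y)) x) ⟩
  2 ^ (n ∸ r) * (suc (suc (x + y)) C suc x) ∎
  where
    open ≡-Reasoning
    r : ℕ
    r = suc (suc (x + y))

H∸x≤1+H∸[1+x] : ∀ H x → H ∸ x ≤ suc (H ∸ suc x)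
H∸x≤1+H∸[1+x] zero    x       = ≤-trans (≤-reflexive (0∸n≡0 x)) z≤n
H∸x≤1+H∸[1+x] (suc H) zero    = ≤-refl
H∸x≤1+H∸[1+x] (suc H) (suc x) = H∸x≤1+H∸[1+x] H x

[1+a]⊓b+a⊓[1+b]≤2[a⊓b]+1 : ∀ a b → suc a ⊓ b + a ⊓ suc b ≤ 2 * (a ⊓ b) + 1
[1+a]⊓b+a⊓[1+b]≤2[a⊓b]+1 zero    zero    = z≤n
[1+a]⊓b+a⊓[1+b]≤2[a⊓b]+1 zero    (suc b) = ≤-refl
[1+a]⊓b+a⊓[1+b]≤2[a⊓b]+1 (suc a) zero    = s≤s (≤-reflexive (⊓-zeroʳ a))
[1+a]⊓b+a⊓[1+b]≤2[a⊓b]+1 (suc a) (suc b) = begin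
  suc (suc a ⊓ b) + suc (a ⊓ suc b) ≡⟨ +-suc (suc (suc a ⊓ b)) (a ⊓ suc b) ⟩
  2 + (suc a ⊓ b + a ⊓ suc b)       ≤⟨ +-monoʳ-≤ 2 ([1+a]⊓b+a⊓[1+b]≤2[a⊓b]+1 a b) ⟩
  2 + (2 * (a ⊓ b) + 1)             ≡⟨ cong (_+ 1) (*-suc 2 (a ⊓ b)) ⟨
  2 * suc (a ⊓ b) + 1               ∎
  where open ≤-Reasoning

1+a≤2a+1 : ∀ a → suc a ≤ 2 * a + 1
1+a≤2a+1 a = ≤-trans (≤-reflexive (+-comm 1 a)) (+-monoˡ-≤ 1 (m≤m+n a (a + 0)))

tent-supersolution : ∀ H x y → inflow (tent H) x y ≤ 2 * tent H x y + 1
tent-supersolution H zero    zero    = z≤n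
tent-supersolution H (suc x) zero    =
  ≤-trans (≤-reflexive (cong (H ∸_) (⊔-identityʳ x))) (≤-trans (H∸x≤1+H∸[1+x] H x) (1+a≤2a+1 _))
tent-supersolution H zero    (suc y) = ≤-trans (H∸x≤1+H∸[1+x] H y) (1+a≤2a+1 _)
tent-supersolution H (suc x) (suc y)
  rewrite ∸-distribˡ-⊔-⊓ H x (suc y) | ∸-distribˡ-⊔-⊓ H (suc x) y | ∸-distribˡ-⊔-⊓ H (suc x) (suc y) =
  ≤-trans (+-mono-≤ (⊓-monoˡ-≤ (H ∸ suc y) (H∸x≤1+H∸[1+x] H x)) (⊓-monoʳ-≤ (H ∸ suc x) (H∸x≤1+H∸[1+x] H y)))
          ([1+a]⊓b+a⊓[1+b]≤2[a⊓b]+1 (H ∸ suc x) (H ∸ suc y))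

tent-support : ∀ H a b → 1 ≤ tent H a b → suc (suc (a + b)) ≤ 2 * H
tent-support H a b 0<tent = begin
  suc (suc (a + b)) ≡⟨ cong suc (+-suc a b) ⟨
  suc a + suc b     ≤⟨ +-mono-≤ (m⊔n<o⇒m<o a b a⊔b<H) (m⊔n<o⇒n<o a b a⊔b<H) ⟩
  H + H             ≡⟨ cong (H +_) (+-identityʳ H) ⟨
  2 * H             ∎
  where
    open ≤-Reasoning
    a⊔b<H : a ⊔ b < H
    a⊔b<H = m∸n≢0⇒n<m (λ tent≡0 → n≮0 (subst (0 <_) tent≡0 0<tent))

a+2m≤2H+1⇒a≤2[H∸m]+1 : ∀ a m H → a + 2 * m ≤ 2 * H + 1 → a ≤ 2 * (H ∸ m) + 1
a+2m≤2H+1⇒a≤2[H∸m]+1 a m H a+2m≤2H+1 = +-cancelˡ-≤ (2 * m) a (2 * (H ∸ m) + 1) (begin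
  2 * m + a                 ≡⟨ +-comm (2 * m) a ⟩
  a + 2 * m                 ≤⟨ a+2m≤2H+1 ⟩
  2 * H + 1                 ≤⟨ +-monoˡ-≤ 1 (*-monoʳ-≤ 2 (m≤n+m∸n H m)) ⟩
  2 * (m + (H ∸ m)) + 1     ≡⟨ distribute m (H ∸ m) ⟩
  2 * m + (2 * (H ∸ m) + 1) ∎)
  where
    open ≤-Reasoning
    distribute : ∀ m d → 2 * (m + d) + 1 ≡ 2 * m + (2 * d + 1)
    distribute = solve-∀

binomial-under-tent : ∀ H x y → x + y + (x + y) C ((x + y) / 2) ≤ 2 * H →
                      (x + y) C x ≤ 2 * tent H x y + 1
binomial-under-tent H x y N+central≤2H = a+2m≤2H+1⇒a≤2[H∸m]+1 _ (x ⊔ y) H (begin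
  N C x + 2 * (x ⊔ y)     ≤⟨ binomial-tilt {N / 2} x y (≤-pred (m%n<n N 2)) (m≡m%n+[m/n]*n N 2) ⟩
  N + 1 + N C (N / 2)     ≡⟨ xy∙z≈xz∙y N 1 (N C (N / 2)) ⟩
  N + N C (N / 2) + 1     ≤⟨ +-monoˡ-≤ 1 N+central≤2H ⟩
  2 * H + 1               ∎)
  where
    open ≤-Reasoning
    N : ℕ
    N = x + y

initial-off-origin : ∀ n x y → 0 < x + y → initial n x y ≡ 0
initial-off-origin n (suc x) y       _ = refl
initial-off-origin n zero    (suc y) _ = refl

inflow-glued-below : ∀ n H x y → x + y ≤ n → inflow (glued n H) x y ≡ inflow (dyadic n) x y
inflow-glued-below n H x y r≤n =
  inflow-cong-row x y (λ a b 1+a+b≡r → glued-below n H a b (≤-trans (≤-reflexive 1+a+b≡r) r≤n))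

inflow-glued-above : ∀ n H x y → n < x + y → inflow (glued n H) x y ≡ inflow (tent H) x y
inflow-glued-above n H x y n<r =
  inflow-cong-row x y (λ a b 1+a+b≡r → glued-above n H a b (≤-pred (≤-trans n<r (≤-reflexive (sym 1+a+b≡r)))))

glued-supersolution : ∀ n H → n + n C (n / 2) ≤ 2 * H → Supersolution (initial n) (glued n H)
glued-supersolution n H n+central≤2H x y with <-cmp (x + y) n
... | tri< r<n _ _ = begin
  initial n x y + inflow (glued n H) x y      ≡⟨ cong (initial n x y +_) (inflow-glued-below n H x y (<⇒≤ r<n)) ⟩
  initial n x y + inflow (dyadic n) x y       ≡⟨ initial+inflow-dyadic n x y ⟩
  2 ^ (n ∸ (x + y)) * ((x + y) C x)           ≡⟨ cong (λ e → 2 ^ e * ((x + y) C x)) (+-∸-assoc 1 r<n) ⟩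
  2 * 2 ^ (n ∸ suc (x + y)) * ((x + y) C x)   ≡⟨ *-assoc 2 (2 ^ (n ∸ suc (x + y))) ((x + y) C x) ⟩
  2 * dyadic n x y                            ≡⟨ cong (2 *_) (glued-below n H x y r<n) ⟨
  2 * glued n H x y                           ≤⟨ m≤m+n _ 1 ⟩
  2 * glued n H x y + 1                       ∎
  where open ≤-Reasoning
... | tri≈ _ refl _ = begin
  initial n x y + inflow (glued n H) x y      ≡⟨ cong (initial n x y +_) (inflow-glued-below n H x y ≤-refl) ⟩
  initial n x y + inflow (dyadic n) x y       ≡⟨ initial+inflow-dyadic n x y ⟩
  2 ^ (n ∸ n) * (n C x)                       ≡⟨ cong (λ e → 2 ^ e * (n C x)) (n∸n≡0 n) ⟩
  1 * (n C x)                                 ≡⟨ *-identityˡ (n C x) ⟩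
  n C x                                       ≤⟨ binomial-under-tent H x y n+central≤2H ⟩
  2 * tent H x y + 1                          ≡⟨ cong (λ t → 2 * t + 1) (glued-above n H x y ≤-refl) ⟨
  2 * glued n H x y + 1                       ∎
  where open ≤-Reasoning
... | tri> _ _ n<r = begin
  initial n x y + inflow (glued n H) x y      ≡⟨ cong₂ _+_ (initial-off-origin n x y (≤-trans (s≤s z≤n) n<r))
                                                            (inflow-glued-above n H x y n<r) ⟩
  inflow (tent H) x y                         ≤⟨ tent-supersolution H x y ⟩
  2 * tent H x y + 1                          ≡⟨ cong (λ t → 2 * t + 1) (glued-above n H x y (<⇒≤ n<r)) ⟨
  2 * glued n H x y + 1                       ∎
  where open ≤-Reasoning

glued-support : ∀ {n H R} → n ≤ R → 2 * H ≤ suc R → ∀ a b → 1 ≤ glued n H a b → suc (a + b) ≤ R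
glued-support {n} {H} n≤R 2H≤1+R a b 0<glued with a + b <? n
... | yes a+b<n = ≤-trans a+b<n n≤R
... | no  a+b≮n = ≤-pred (≤-trans (tent-support H a b 0<tent) 2H≤1+R)
  where
    0<tent : 1 ≤ tent H a b
    0<tent = subst (1 ≤_) (glued-above n H a b (≮⇒≥ a+b≮n)) 0<glued

initial-support : ∀ {n R} x y → 1 ≤ initial n x y → x + y ≤ R
initial-support zero zero _ = z≤n

n≤2⌈n/2⌉ : ∀ n → n ≤ 2 * ⌈ n /2⌉
n≤2⌈n/2⌉ zero = z≤n
n≤2⌈n/2⌉ (suc zero) = s≤s z≤n
n≤2⌈n/2⌉ (suc (suc n)) = subst (suc (suc n) ≤_) (sym (*-suc 2 ⌈ n /2⌉)) (s≤s (s≤s (n≤2⌈n/2⌉ n)))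

2⌈n/2⌉≤1+n : ∀ n → 2 * ⌈ n /2⌉ ≤ suc n
2⌈n/2⌉≤1+n zero = z≤n
2⌈n/2⌉≤1+n (suc zero) = ≤-refl
2⌈n/2⌉≤1+n (suc (suc n)) = subst (_≤ suc (suc (suc n))) (sym (*-suc 2 ⌈ n /2⌉)) (s≤s (s≤s (2⌈n/2⌉≤1+n n)))

m≤1+2[m/2] : ∀ m → m ≤ 1 + 2 * (m / 2)
m≤1+2[m/2] m = begin
  m                   ≡⟨ m≡m%n+[m/n]*n m 2 ⟩
  m % 2 + m / 2 * 2   ≤⟨ +-monoˡ-≤ (m / 2 * 2) (≤-pred (m%n<n m 2)) ⟩
  1 + m / 2 * 2       ≡⟨ cong (1 +_) (*-comm (m / 2) 2) ⟩
  1 + 2 * (m / 2)     ∎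
  where open ≤-Reasoning

proposition6p7 : (n : ℕ) (c : Config) → Reachable (initial n) c → Stable c →
    ∀ x y → 1 ≤ c x y →
      (n % 2 ≡ 0 → x + y ≤ n + (n C (n / 2))) ×
      (n % 2 ≡ 1 → x + y ≤ n + 1 + 2 * ((n C (n / 2)) / 2))
proposition6p7 n c reach _ x y 0<c = (λ _ → x+y≤n+m) , (λ _ → ≤-trans x+y≤n+m n+m≤n+1+2[m/2])
  where
    m H : ℕ
    m = n C (n / 2)
    H = ⌈ n + m /2⌉
    x+y≤n+m : x + y ≤ n + m
    x+y≤n+m = reachable-support (glued-supersolution n H (n≤2⌈n/2⌉ (n + m))) (initial-support {n})
                (glued-support (m≤m+n n m) (2⌈n/2⌉≤1+n (n + m))) reach x y 0<c
    n+m≤n+1+2[m/2] : n + m ≤ n + 1 + 2 * (m / 2)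
    n+m≤n+1+2[m/2] = ≤-trans (+-monoʳ-≤ n (m≤1+2[m/2] m)) (≤-reflexive (sym (+-assoc n 1 _)))
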